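{- Let $\mathcal{E}$ be a bundle event structure, $\alpha\in\mathcal{T}(\mathcal{E})$ an event trace, and $x\in\mathcal{C}(\mathcal{E})$ a configuration with $x\subseteq\bar\alpha$, where $\bar\alpha$ is the set of events occurring in $\alpha$. Then the restriction $\alpha|_x$ of $\alpha$ to the events in $x$ (keeping their order) is an event trace of $\mathcal{E}$.
   Context: A bundle event structure (BES) is $\mathcal{E}=(E,\#,\mapsto,\lambda,\Phi)$: $E$ a set of events; $\#\subseteq E\times E$ irreflexive symmetric; for $x,y\subseteq E$, $x\#y$ means $e\#f$ for all $e\in x,f\in y$ with $e\neq f$; $\mapsto\subseteq\mathcal{P}(E)\times E$ with $x\mapsto e\Rightarrow x\#x$; $\lambda$ a partial labelling; $\Phi\subseteq E$ with $\Phi\#\Phi$. Let $\mathrm{cfl}(x)=\{e\mid\exists e'\in x:e\#e'\}$. An event trace is a finite sequence $e_1\cdots e_n$ such that for each $i$, $e_i\notin\mathrm{cfl}(\{e_1,\dots,e_{i-1}\})\cup\{e_1,\dots,e_{i-1}\}$ and for each bundle $z\mapsto e_i$ there is $j<i$ with $e_j\in z$; $\mathcal{T}(\mathcal{E})$ is the set of event traces. A configuration is the set of events of an event trace; $\mathcal{C}(\mathcal{E})$ is the set of configurations. -}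

module Defs where

open import Level using (Level; suc; _⊔_)
open import Data.List using (List; []; _∷_; _∷ʳ_)
open import Data.List.Membership.Propositional using (_∈_)
open import Data.Product using (Σ; ∃; _×_; _,_)
open import Data.Maybe using (Maybe)
open import Relation.Nullary using (¬_)
open import Relation.Binary.PropositionalEquality using (_≡_)

Pred : Set → Set₁
Pred E = E → Set

_⊆_ : {E : Set} → Pred E → Pred E → Set
x ⊆ y = ∀ e → x e → y e

record BES (L : Set) : Set₁ where
  field
    Ev      : Set
    _#_     : Ev → Ev → Set
    #-irrefl : ∀ e → ¬ (e # e)
    #-sym   : ∀ e f → e # f → f # e
    _↦_     : Pred Ev → Ev → Set
    bundle-conf : ∀ z e → z ↦ e → ∀ a b → z a → z b → ¬ (a ≡ b) → a # b
    lab     : Ev → Maybe L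
    Φ       : Pred Ev
    Φ-conf  : ∀ a b → Φ a → Φ b → ¬ (a ≡ b) → a # b

module _ {L : Set} (𝓔 : BES L) where
  open BES 𝓔

  cfl : List Ev → Pred Ev
  cfl xs e = Σ Ev λ e' → e' ∈ xs × (e # e')

  -- e may be appended after the prefix `pre` (listed in order e₁ … e_{i-1})
  Enabled : List Ev → Ev → Set₁
  Enabled pre e =
    ¬ cfl pre e × ¬ (e ∈ pre) × (∀ z → z ↦ e → Σ Ev λ f → f ∈ pre × z f)

  data IsTrace : List Ev → Set₁ where
    []  : IsTrace []
    snoc : ∀ {pre e} → IsTrace pre → Enabled pre e → IsTrace (pre ∷ʳ e)

  events : List Ev → Pred Ev
  events α e = e ∈ α

  IsConfiguration : Pred Ev → Set₁
  IsConfiguration x = Σ (List Ev) λ β → IsTrace β × (∀ e → x e → e ∈ β) × (∀ e → e ∈ β → x e)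

-- Restriction α|ₓ : `Restrict x α β` holds iff β is α with the events not in x
-- removed (order kept).
data Restrict {E : Set} (x : Pred E) : List E → List E → Set where
  []    : Restrict x [] []
  keep  : ∀ {e α β} → x e → Restrict x α β → Restrict x (e ∷ α) (e ∷ β)
  drop  : ∀ {e α β} → ¬ x e → Restrict x α β → Restrict x (e ∷ α) β

module Submission where

-- Let e be an event of α|ₓ and z ↦ e a bundle. Since α is a trace, some
-- f ∈ z occurs before e in α. If f ∈ x, then f also occurs before e in α|ₓ and
-- we are done. Otherwise, x is a configuration, so its bundles are satisfied
-- inside x: some f' ∈ z lies in x ⊆ ᾱ. Now f and f' both lie in the bundle z and
-- in ᾱ, which is conflict-free; as distinct events of a bundle are in conflict,
-- f = f' (up to double negation), contradicting f ∉ x. Conflict-freeness and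
-- "no repetition" are inherited by α|ₓ because its prefixes are sub-lists of
-- prefixes of α.

open import Defs
open import Data.List using (List; []; _∷_; _∷ʳ_)
open import Data.List.Membership.Propositional using (_∈_)
open import Data.List.Membership.Propositional.Properties using (∈-++⁺ˡ; ∈-++⁻)
open import Data.List.Relation.Unary.Any using (here; there)
open import Data.Product using (Σ; _×_; _,_)
open import Data.Sum using (_⊎_; inj₁; inj₂)
open import Data.Empty using (⊥-elim)
open import Relation.Nullary using (¬_)
open import Relation.Binary.PropositionalEquality using (_≡_; refl; sym; subst)

init-⊆ : ∀ {E : Set} {c : Pred E} {α e} → (∀ f → f ∈ α ∷ʳ e → c f) → ∀ f → f ∈ α → c f
init-⊆ α⊆c f f∈ = α⊆c f (∈-++⁺ˡ f∈)

module _ {E : Set} {x : Pred E} where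

  restrict-⊆ : ∀ {α β f} → Restrict x α β → f ∈ β → f ∈ α
  restrict-⊆ (keep _ r) (here eq) = here eq
  restrict-⊆ (keep _ r) (there m) = there (restrict-⊆ r m)
  restrict-⊆ (drop _ r) m         = there (restrict-⊆ r m)

  restrict-keeps : ∀ {α β f} → Restrict x α β → x f → f ∈ α → f ∈ β
  restrict-keeps (keep _ r)  xf (here eq)   = here eq
  restrict-keeps (keep _ r)  xf (there m)   = there (restrict-keeps r xf m)
  restrict-keeps (drop nx r) xf (here refl) = ⊥-elim (nx xf)
  restrict-keeps (drop nx r) xf (there m)   = restrict-keeps r xf m

  -- A restriction witness decides membership in x for each event of α
  -- (x itself need not be decidable).
  restrict-decides : ∀ {α β f} → Restrict x α β → f ∈ α → x f ⊎ ¬ x f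
  restrict-decides (keep xe _) (here refl) = inj₁ xe
  restrict-decides (drop nx _) (here refl) = inj₂ nx
  restrict-decides (keep _ r)  (there m)   = restrict-decides r m
  restrict-decides (drop _ r)  (there m)   = restrict-decides r m

  data RestrictSnoc (α : List E) (e : E) : List E → Set where
    kept    : ∀ {β} → x e → Restrict x α β → RestrictSnoc α e (β ∷ʳ e)
    dropped : ∀ {β} → ¬ x e → Restrict x α β → RestrictSnoc α e β

  restrict-snoc : ∀ α e {β} → Restrict x (α ∷ʳ e) β → RestrictSnoc α e β
  restrict-snoc []      e (keep xe []) = kept xe []
  restrict-snoc []      e (drop nx []) = dropped nx []
  restrict-snoc (a ∷ α) e (keep xa r) with restrict-snoc α e r
  ... | kept xe r'    = kept xe (keep xa r')
  ... | dropped nx r' = dropped nx (keep xa r')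
  restrict-snoc (a ∷ α) e (drop na r) with restrict-snoc α e r
  ... | kept xe r'    = kept xe (drop na r')
  ... | dropped nx r' = dropped nx (drop na r')

module _ {L : Set} (𝓔 : BES L) where
  open BES 𝓔

  ConflictFree : Pred Ev → Set
  ConflictFree c = ∀ a b → c a → c b → ¬ (a # b)

  BundleClosed : Pred Ev → Set₁
  BundleClosed x = ∀ e z → x e → z ↦ e → Σ Ev λ f → x f × z f

  trace-conflict-free : ∀ {α} → IsTrace 𝓔 α → ConflictFree (events 𝓔 α)
  trace-conflict-free [] a b ()
  trace-conflict-free (snoc {pre} {e} t (no-cfl , _ , _)) a b a∈ b∈
    with ∈-++⁻ pre a∈ | ∈-++⁻ pre b∈
  ... | inj₁ a∈pre      | inj₁ b∈pre      = trace-conflict-free t a b a∈pre b∈pre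
  ... | inj₂ (here refl) | inj₁ b∈pre      = λ c → no-cfl (b , b∈pre , c)
  ... | inj₁ a∈pre      | inj₂ (here refl) = λ c → no-cfl (a , a∈pre , #-sym a e c)
  ... | inj₂ (here refl) | inj₂ (here refl) = #-irrefl e

  trace-satisfies-bundles : ∀ {α e z} → IsTrace 𝓔 α → e ∈ α → z ↦ e →
                            Σ Ev λ f → f ∈ α × z f
  trace-satisfies-bundles [] () _
  trace-satisfies-bundles (snoc {pre} t (_ , _ , enabled)) e∈ z↦e with ∈-++⁻ pre e∈
  ... | inj₁ e∈pre =
    let (f , f∈pre , zf) = trace-satisfies-bundles t e∈pre z↦e in f , ∈-++⁺ˡ f∈pre , zf
  ... | inj₂ (here refl) =
    let (f , f∈pre , zf) = enabled _ z↦e in f , ∈-++⁺ˡ f∈pre , zf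

  configuration-bundle-closed : ∀ {x} → IsConfiguration 𝓔 x → BundleClosed x
  configuration-bundle-closed (γ , tγ , x⊆γ , γ⊆x) e z xe z↦e =
    let (f , f∈γ , zf) = trace-satisfies-bundles tγ (x⊆γ e xe) z↦e in f , γ⊆x f f∈γ , zf

  -- A conflict-free set meets a bundle in at most one event (distinct members of
  -- a bundle are in conflict).
  bundle-meets-once : ∀ {c z e f f'} → ConflictFree c → z ↦ e →
                      c f → c f' → z f → z f' → ¬ ¬ (f ≡ f')
  bundle-meets-once {f = f} {f'} cf z↦e cf-f cf-f' zf zf' f≢f' =
    cf f f' cf-f cf-f' (bundle-conf _ _ z↦e f f' zf zf' f≢f')

  restriction-is-trace : ∀ {c x} → ConflictFree c → BundleClosed x → x ⊆ c →
                         ∀ {α β} → IsTrace 𝓔 α → (∀ e → e ∈ α → c e) →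
                         Restrict x α β → IsTrace 𝓔 β
  restriction-is-trace cf closed x⊆c [] α⊆c [] = []
  restriction-is-trace {x = x} cf closed x⊆c (snoc {pre} {e} t (no-cfl , fresh , enabled)) α⊆c r
    with restrict-snoc pre e r
  ... | dropped _ r' = restriction-is-trace cf closed x⊆c t (init-⊆ α⊆c) r'
  ... | kept {β'} xe r' =
    snoc (restriction-is-trace cf closed x⊆c t (init-⊆ α⊆c) r') (no-cfl' , fresh' , enabled')
    where
    no-cfl' : ¬ cfl 𝓔 β' e
    no-cfl' (f , f∈ , e#f) = no-cfl (f , restrict-⊆ r' f∈ , e#f)

    fresh' : ¬ (e ∈ β')
    fresh' e∈ = fresh (restrict-⊆ r' e∈)

    -- The event f satisfying z in α is kept unless f ∉ x; in that case the
    -- witness f' ∈ x of z would be a second, hence conflicting, event of z in c.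
    enabled' : ∀ z → z ↦ e → Σ Ev λ f → f ∈ β' × z f
    enabled' z z↦e with enabled z z↦e
    ... | f , f∈pre , zf with restrict-decides r' f∈pre
    ...   | inj₁ xf = f , restrict-keeps r' xf f∈pre , zf
    ...   | inj₂ ¬xf =
      let (f' , xf' , zf') = closed e z xe z↦e in
      ⊥-elim (bundle-meets-once cf z↦e (α⊆c f (∈-++⁺ˡ f∈pre)) (x⊆c f' xf') zf zf'
                (λ f≡f' → ¬xf (subst x (sym f≡f') xf')))

lemma1 : {L : Set} (𝓔 : BES L) (α : List (BES.Ev 𝓔)) (x : Pred (BES.Ev 𝓔)) →
         IsTrace 𝓔 α → IsConfiguration 𝓔 x → x ⊆ events 𝓔 α →
         (β : List (BES.Ev 𝓔)) → Restrict x α β → IsTrace 𝓔 β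
lemma1 𝓔 α x tα conf x⊆α β r =
  restriction-is-trace 𝓔 (trace-conflict-free 𝓔 tα) (configuration-bundle-closed 𝓔 conf)
    x⊆α tα (λ _ e∈α → e∈α) r
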